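{- Let $n\ge1$, $0\le k\le n$ and $w\in\mathcal{W}^{(k)}_n$, written $w=u_1\cdots u_k\,|\,\overline{\lambda_r}\cdots\overline{\lambda_1}\,v_1\cdots v_{n-k-r}$. For $1\le i\le k$ set $d_i=\#\{j:\lambda_j>u_i\}$ and $\alpha_i=u_i-i+d_i$. Then $\ell(w)=\sum_{i=1}^k\alpha_i+\sum_{j=1}^r\lambda_j$.
   Context: $\mathcal{W}_n$ is the group of signed permutations of $\{ -n,\dots,n\}$ ($w(-i)=-w(i)$), written in one-line notation $w(1)\cdots w(n)$ with $\overline{a}=-a$. It is a Coxeter group generated by $s_0$ (sign change of the entry in position 1) and $s_i$, $1\le i\le n-1$ (swap of entries in positions $i,i+1$); $\ell(w)$ is the Coxeter length with respect to these generators. $\mathcal{W}^{(k)}_n$ is the set of $w\in\mathcal{W}_n$ whose one-line notation has the form $u_1\cdots u_k\,|\,\overline{\lambda_r}\cdots\overline{\lambda_1}\,v_1\cdots v_{n-k-r}$ for some $r\ge0$, with $0<u_1<\dots<u_k$, $0<\lambda_1<\dots<\lambda_r$, $0<v_1<\dots<v_{n-k-r}$. -}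

module Defs where

open import Data.Nat using (ℕ; zero; suc; _+_; _∸_; _≤_; _<_; _<?_)
open import Data.Integer as ℤ using (ℤ; +_; -_; ∣_∣)
open import Data.Fin using (Fin; toℕ)
open import Data.List using (List; []; _∷_; map; foldl; length; upTo; filter; zipWith; _++_; reverse)
open import Data.List.Relation.Unary.All using (All)
open import Data.List.Relation.Unary.Linked using (Linked)
open import Data.List.Relation.Binary.Permutation.Propositional using (_↭_)
open import Data.Product using (Σ; _×_)
open import Relation.Binary.PropositionalEquality using (_≡_)

-- A signed permutation of {-n..n} is represented by its one-line notation
-- w(1) ... w(n), a list of nonzero integers whose absolute values are a
-- permutation of 1..n.
IsSignedPerm : ℕ → List ℤ → Set
IsSignedPerm n w = map ∣_∣ w ↭ map suc (upTo n)

idW : ℕ → List ℤ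
idW n = map (λ i → + suc i) (upTo n)

swapAt : ∀ {A : Set} → ℕ → List A → List A
swapAt zero    (x ∷ y ∷ xs) = y ∷ x ∷ xs
swapAt (suc i) (x ∷ xs)     = x ∷ swapAt i xs
swapAt _       xs           = xs

-- right multiplication by the generator s_i acting on one-line notation:
-- s_0 changes the sign of the entry in position 1,
-- s_i (1 ≤ i ≤ n-1) swaps the entries in positions i, i+1.
applyGen : ℕ → List ℤ → List ℤ
applyGen zero    []       = []
applyGen zero    (x ∷ xs) = (- x) ∷ xs
applyGen (suc i) xs       = swapAt i xs

-- generators of W_n are indexed by Fin n  (s_0, ..., s_{n-1})
-- the word s_{a1} s_{a2} ... s_{am} evaluates to id·s_{a1}·...·s_{am}
evalWord : (n : ℕ) → List (Fin n) → List ℤ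
evalWord n ws = foldl (λ w a → applyGen (toℕ a) w) (idW n) ws

CoxeterLength : (n : ℕ) → List ℤ → ℕ → Set
CoxeterLength n w m =
  Σ (List (Fin n)) (λ ws → length ws ≡ m × evalWord n ws ≡ w)
  × (∀ (ws : List (Fin n)) → evalWord n ws ≡ w → m ≤ length ws)

oneLine : List ℕ → List ℕ → List ℕ → List ℤ
oneLine u lam v = map +_ u ++ reverse (map (λ x → - (+ x)) lam) ++ map +_ v

dCount : List ℕ → ℕ → ℕ
dCount lam x = length (filter (x <?_) lam)

-- α_i = u_i - i + d_i  (i is 1-indexed; u_i ≥ i so truncated subtraction is exact)
alphas : List ℕ → List ℕ → List ℕ
alphas u lam = zipWith (λ i ui → (ui + dCount lam ui) ∸ suc i) (upTo (length u)) u

IncPos : List ℕ → Set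
IncPos xs = All (λ x → 0 < x) xs × Linked _<_ xs

module Submission where

-- The proof identifies the Coxeter length with the type-B inversion number
--   inv(w) = #{i : w(i) < 0} + Σ_{i<j} ([w(i) > w(j)] + [w(i) + w(j) < 0])
-- and then evaluates inv block by block on the one-line notation u | λ̄ v.
--   1. Every generator changes inv by at most one and inv(id) = 0, so every
--      word for w has length ≥ inv(w)  (inv≤wordLength).
--   2. A signed permutation which is not the identity has a negative first
--      entry or an adjacent descent; the corresponding generator lowers inv by
--      exactly one.  Iterating gives a word of length inv(w)  (reducedWord).
--      Hence ℓ(w) = inv(w)  (coxeterLength-inv).
--   3. On u | λ̄ v the blocks u and v contribute nothing, λ̄ contributes
--      r + Σ_j #{λ below λ_j}, and the cross terms count comparisons between
--      the blocks (inv-oneLine-blocks).  As the absolute values are a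
--      permutation of 1..n, every entry x equals 1 + #{entries below x}
--      (rank-perm); this turns the block count into Σ α_i + Σ λ_j.

open import Defs
open import Function using (_∘_; id)
open import Data.Nat using (ℕ; zero; suc; _+_; _∸_; _≤_; _<_; z≤n; s≤s; _<?_)
open import Data.Nat.Properties
open import Data.Integer using (ℤ; +_; -[1+_]; -_; ∣_∣)
open import Data.Integer.Properties using (neg-involutive; ∣-i∣≡∣i∣)
open import Data.Fin using (Fin; toℕ; fromℕ<)
open import Data.Fin.Properties using (toℕ-fromℕ<)
open import Data.List
  using (List; []; _∷_; [_]; map; foldl; length; upTo; applyUpTo; zipWith; _++_; reverse)
open import Data.List.Properties
  using (map-++; map-∘; map-id; map-cong; map-upTo; foldl-++; length-++; length-map;
         length-reverse; reverse-map; unfold-reverse; filter-accept; filter-reject)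
open import Data.List.Membership.Propositional using (_∈_)
open import Data.List.Membership.Propositional.Properties using (∈-map⁻; ∈-++⁺ˡ; ∈-++⁺ʳ)
open import Data.List.Relation.Unary.Any using (here; there)
open import Data.List.Relation.Unary.All as All using (All; []; _∷_)
open import Data.List.Relation.Unary.Linked as Linked using (Linked; []; [-]; _∷_)
open import Data.List.Relation.Unary.Linked.Properties using (Linked⇒All; applyUpTo⁺₂)
open import Data.List.Relation.Unary.Sorted.TotalOrder.Properties using (↗↭↗⇒≋)
open import Data.List.Relation.Binary.Pointwise using (Pointwise-≡⇒≡)
open import Data.List.Relation.Binary.Permutation.Propositional
  using (_↭_; ↭-refl; ↭-sym; ↭-trans; prep; swap; ↭⇒↭ₛ)
open import Data.List.Relation.Binary.Permutation.Propositional.Properties as ↭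
  using (∈-resp-↭; ↭-reverse; ++⁺ˡ; ++⁺ʳ)
open import Data.Nat.ListAction using (sum)
open import Data.Nat.ListAction.Properties using (sum-++; sum-↭)
open import Data.Nat.Tactic.RingSolver using (solve-∀)
open import Data.Product using (Σ; _×_; _,_; proj₁; proj₂)
open import Data.Sum using (_⊎_; inj₁; inj₂)
open import Relation.Nullary using (yes; no)
open import Relation.Binary.PropositionalEquality
  using (_≡_; refl; sym; trans; cong; cong₂; subst; module ≡-Reasoning)

sumOf : {A : Set} → (A → ℕ) → List A → ℕ
sumOf f xs = sum (map f xs)

sumOf-++ : ∀ {A : Set} (f : A → ℕ) xs ys → sumOf f (xs ++ ys) ≡ sumOf f xs + sumOf f ys
sumOf-++ f xs ys = trans (cong sum (map-++ f xs ys)) (sum-++ (map f xs) (map f ys))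

sumOf-↭ : ∀ {A : Set} (f : A → ℕ) {xs ys} → xs ↭ ys → sumOf f xs ≡ sumOf f ys
sumOf-↭ f p = sum-↭ (↭.map⁺ f p)

sumOf-map : ∀ {A B : Set} (f : B → ℕ) (g : A → B) xs → sumOf f (map g xs) ≡ sumOf (f ∘ g) xs
sumOf-map f g xs = cong sum (sym (map-∘ xs))

sumOf-+ : ∀ {A : Set} (f g : A → ℕ) xs → sumOf (λ x → f x + g x) xs ≡ sumOf f xs + sumOf g xs
sumOf-+ f g [] = refl
sumOf-+ f g (x ∷ xs) =
  trans (cong (_+_ (f x + g x)) (sumOf-+ f g xs)) (interchange (f x) (g x) (sumOf f xs) (sumOf g xs))
  where
  interchange : ∀ a b p q → a + b + (p + q) ≡ a + p + (b + q)
  interchange = solve-∀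

sumOf-suc : ∀ {A : Set} (f : A → ℕ) xs → sumOf (λ x → suc (f x)) xs ≡ length xs + sumOf f xs
sumOf-suc f [] = refl
sumOf-suc f (x ∷ xs) = cong suc (trans (cong (_+_ (f x)) (sumOf-suc f xs)) (+-comm-middle (f x) (length xs) (sumOf f xs)))
  where
  +-comm-middle : ∀ p q r → p + (q + r) ≡ q + (p + r)
  +-comm-middle = solve-∀

sumOf-congᴬ : ∀ {A : Set} {f g : A → ℕ} {xs} → All (λ x → f x ≡ g x) xs → sumOf f xs ≡ sumOf g xs
sumOf-congᴬ [] = refl
sumOf-congᴬ (p ∷ ps) = cong₂ _+_ p (sumOf-congᴬ ps)

sumOf-zero : ∀ {A : Set} {f : A → ℕ} {xs} → All (λ x → f x ≡ 0) xs → sumOf f xs ≡ 0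
sumOf-zero [] = refl
sumOf-zero (p ∷ ps) = cong₂ _+_ p (sumOf-zero ps)

lt : ℕ → ℕ → ℕ
lt _       zero    = 0
lt zero    (suc _) = 1
lt (suc a) (suc b) = lt a b

same : ℕ → ℕ → ℕ
same zero    zero    = 1
same zero    (suc _) = 0
same (suc _) zero    = 0
same (suc a) (suc b) = same a b

lt-< : ∀ {a b} → a < b → lt a b ≡ 1
lt-< {zero}  {suc b} _       = refl
lt-< {suc a} {suc b} (s≤s p) = lt-< p

lt-≥ : ∀ {a b} → b ≤ a → lt a b ≡ 0
lt-≥ {_}     {zero}  _       = refl
lt-≥ {suc a} {suc b} (s≤s p) = lt-≥ p

lt≤1 : ∀ a b → lt a b ≤ 1
lt≤1 _       zero    = z≤n
lt≤1 zero    (suc _) = s≤s z≤n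
lt≤1 (suc a) (suc b) = lt≤1 a b

lt-irrefl : ∀ a → lt a a ≡ 0
lt-irrefl a = lt-≥ {a} {a} ≤-refl

same-refl : ∀ a → same a a ≡ 1
same-refl zero    = refl
same-refl (suc a) = same-refl a

trichotomy : ∀ x y → lt y x + same x y + lt x y ≡ 1
trichotomy zero    zero    = refl
trichotomy zero    (suc y) = refl
trichotomy (suc x) zero    = refl
trichotomy (suc x) (suc y) = trichotomy x y

below copies above : ℕ → List ℕ → ℕ
below  x = sumOf (λ y → lt y x)
copies x = sumOf (same x)
above  x = sumOf (lt x)

counts-partition : ∀ x ys → below x ys + copies x ys + above x ys ≡ length ys
counts-partition x [] = refl
counts-partition x (y ∷ ys) =
  trans (regroup (lt y x) (same x y) (lt x y) (below x ys) (copies x ys) (above x ys))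
        (cong₂ _+_ (trichotomy x y) (counts-partition x ys))
  where
  regroup : ∀ a b d p q r → a + p + (b + q) + (d + r) ≡ (a + b + d) + (p + q + r)
  regroup = solve-∀

∈⇒copies : ∀ {x ys} → x ∈ ys → 1 ≤ copies x ys
∈⇒copies {x} (here refl) = ≤-trans (≤-reflexive (sym (same-refl x))) (m≤m+n _ _)
∈⇒copies     (there x∈)  = ≤-trans (∈⇒copies x∈) (m≤n+m _ _)

below-of-larger : ∀ {x ys} → All (x <_) ys → below x ys ≡ 0
below-of-larger = sumOf-zero ∘ All.map (lt-≥ ∘ <⇒≤)

above-of-larger : ∀ {x ys} → All (x <_) ys → above x ys ≡ length ys
above-of-larger []       = refl
above-of-larger (p ∷ ps) = cong₂ _+_ (lt-< p) (above-of-larger ps)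

-- Σ_{x ∈ u} #{λ above x} = Σ_{y ∈ λ} #{u below y}: both count the pairs x < y
double-count : ∀ u lam → sumOf (λ x → above x lam) u ≡ sumOf (λ y → below y u) lam
double-count []      lam = sym (sumOf-zero (All.universal (λ _ → refl) lam))
double-count (x ∷ u) lam =
  trans (cong (_+_ (above x lam)) (double-count u lam)) (sym (sumOf-+ (lt x) (λ y → below y u) lam))

dCount≡above : ∀ lam x → dCount lam x ≡ above x lam
dCount≡above []        x = refl
dCount≡above (y ∷ lam) x with x <? y
... | yes x<y = trans (cong length (filter-accept (x <?_) x<y)) (cong₂ _+_ (sym (lt-< x<y)) (dCount≡above lam x))
... | no  x≮y = trans (cong length (filter-reject (x <?_) x≮y)) (cong₂ _+_ (sym (lt-≥ (≮⇒≥ x≮y))) (dCount≡above lam x))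

linked-head : ∀ {R : ℕ → ℕ → Set} → (∀ {a b c} → R a b → R b c → R a c) →
  ∀ {x xs} → Linked R (x ∷ xs) → All (R x) xs
linked-head trans′ [-]        = []
linked-head trans′ (x≺y ∷ lk) = Linked⇒All trans′ x≺y lk

-- the i-th entry (from 0) of a strictly increasing list has exactly i entries below it;
-- hence an index-weighted sum along it can be written as a sum over the entries
sum-zipWith-rank : ∀ (g : ℕ → ℕ → ℕ) (f : ℕ → ℕ) us → Linked _<_ us →
  sum (zipWith g (applyUpTo f (length us)) us) ≡ sumOf (λ x → g (f (below x us)) x) us
sum-zipWith-rank g f []       _  = refl
sum-zipWith-rank g f (x ∷ us) lk = cong₂ _+_ head-rank
  (trans (sum-zipWith-rank g (f ∘ suc) us (Linked.tail lk)) (sumOf-congᴬ (All.map tail-rank (linked-head <-trans lk))))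
  where
  head-rank : g (f 0) x ≡ g (f (lt x x + below x us)) x
  head-rank = cong (λ t → g (f t) x) (sym (cong₂ _+_ (lt-irrefl x) (below-of-larger (linked-head <-trans lk))))
  tail-rank : ∀ {z} → x < z → g (f (suc (below z us))) z ≡ g (f (lt x z + below z us)) z
  tail-rank {z} x<z = cong (λ t → g (f (t + below z us)) z) (sym (lt-< x<z))

sum-below-self : ∀ {x xs} → Linked _<_ (x ∷ xs) →
  sumOf (λ y → below y (x ∷ xs)) (x ∷ xs) ≡ length xs + sumOf (λ y → below y xs) xs
sum-below-self {x} {xs} lk = begin
  lt x x + below x xs + sumOf (λ y → lt x y + below y xs) xs
    ≡⟨ cong₂ _+_ (cong₂ _+_ (lt-irrefl x) (below-of-larger x<xs)) (sumOf-+ (lt x) (λ y → below y xs) xs) ⟩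
  above x xs + sumOf (λ y → below y xs) xs
    ≡⟨ cong (_+ sumOf (λ y → below y xs) xs) (above-of-larger x<xs) ⟩
  length xs + sumOf (λ y → below y xs) xs ∎
  where
  open ≡-Reasoning
  x<xs : All (x <_) xs
  x<xs = linked-head <-trans lk

-- Ranks in a permutation of 1..n

oneTo : ℕ → List ℕ
oneTo n = map suc (upTo n)

below-shift : ∀ x ys → below (suc x) (map suc ys) ≡ below x ys
below-shift x ys = sumOf-map (λ y → lt y (suc x)) suc ys

copies-shift : ∀ x ys → copies (suc x) (map suc ys) ≡ copies x ys
copies-shift x ys = sumOf-map (same (suc x)) suc ys

upTo-suc : ∀ n → applyUpTo suc n ≡ map suc (upTo n)
upTo-suc n = sym (map-upTo suc n)

rank-upTo : ∀ n {y} → y ∈ upTo n → below y (upTo n) ≡ y × copies y (upTo n) ≡ 1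
rank-upTo (suc n) (here refl) =
  sumOf-zero (All.universal (λ _ → refl) (applyUpTo suc n)) ,
  cong suc (trans (cong (copies 0) (upTo-suc n))
                  (trans (sumOf-map (same 0) suc (upTo n)) (sumOf-zero (All.universal (λ _ → refl) (upTo n)))))
rank-upTo (suc n) (there y∈) with ∈-map⁻ suc (subst (_ ∈_) (upTo-suc n) y∈)
... | y , y∈′ , refl =
  cong suc (trans (cong (below (suc y)) (upTo-suc n)) (trans (below-shift y (upTo n)) (proj₁ (rank-upTo n y∈′)))) ,
  trans (cong (copies (suc y)) (upTo-suc n)) (trans (copies-shift y (upTo n)) (proj₂ (rank-upTo n y∈′)))

rank-perm : ∀ {n S x} → S ↭ oneTo n → x ∈ S → x ≡ suc (below x S) × copies x S ≡ 1
rank-perm {n} {S} p x∈ with ∈-map⁻ suc (∈-resp-↭ p x∈)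
... | y , y∈ , refl =
  cong suc (sym (trans (sumOf-↭ _ p) (trans (below-shift y (upTo n)) (proj₁ (rank-upTo n y∈))))) ,
  trans (sumOf-↭ _ p) (trans (copies-shift y (upTo n)) (proj₂ (rank-upTo n y∈)))

-- The type-B inversion number

neg : ℤ → ℕ
neg (+ _)    = 0
neg -[1+ _ ] = 1

-- the contribution [x > y] + [x + y < 0] of an entry x standing before an entry y
pairInv : ℤ → ℤ → ℕ
pairInv (+ a)    (+ b)    = lt b a
pairInv (+ a)    -[1+ b ] = suc (lt a (suc b))
pairInv -[1+ a ] (+ b)    = lt b (suc a)
pairInv -[1+ a ] -[1+ b ] = suc (lt a b)

invNum : List ℤ → ℕ
invNum []       = 0
invNum (x ∷ xs) = neg x + sumOf (pairInv x) xs + invNum xs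

pairInv-negate : ∀ x y → pairInv (- x) y ≡ pairInv x y
pairInv-negate (+ zero)  y          = refl
pairInv-negate (+ suc a) (+ b)      = refl
pairInv-negate (+ suc a) -[1+ b ]   = refl
pairInv-negate -[1+ a ]  (+ b)      = refl
pairInv-negate -[1+ a ]  -[1+ b ]   = refl

pairInv-flip : ∀ x y → pairInv y x ≤ suc (pairInv x y)
pairInv-flip (+ a)    (+ b)    = ≤-trans (lt≤1 a b) (s≤s z≤n)
pairInv-flip (+ a)    -[1+ b ] = ≤-trans (n≤1+n _) (n≤1+n _)
pairInv-flip -[1+ a ] (+ b)    = ≤-refl
pairInv-flip -[1+ a ] -[1+ b ] = s≤s (≤-trans (lt≤1 b a) (s≤s z≤n))

swapAt-↭ : ∀ {A : Set} j (xs : List A) → swapAt j xs ↭ xs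
swapAt-↭ zero    []           = ↭-refl
swapAt-↭ zero    (x ∷ [])     = ↭-refl
swapAt-↭ zero    (x ∷ y ∷ xs) = swap y x ↭-refl
swapAt-↭ (suc j) []           = ↭-refl
swapAt-↭ (suc j) (x ∷ xs)     = prep x (swapAt-↭ j xs)

invNum-swap-head : ∀ x y zs →
  invNum (y ∷ x ∷ zs) + pairInv x y ≡ invNum (x ∷ y ∷ zs) + pairInv y x
invNum-swap-head x y zs =
  regroup (neg y) (pairInv y x) (sumOf (pairInv y) zs) (neg x) (sumOf (pairInv x) zs) (invNum zs) (pairInv x y)
  where
  regroup : ∀ a b c d e f g → a + (b + c) + (d + e + f) + g ≡ d + (g + e) + (a + c + f) + b
  regroup = solve-∀

invNum-cons-swapAt : ∀ x j ws → invNum (x ∷ swapAt j ws) ≡ neg x + sumOf (pairInv x) ws + invNum (swapAt j ws)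
invNum-cons-swapAt x j ws = cong (λ t → neg x + t + invNum (swapAt j ws)) (sumOf-↭ (pairInv x) (swapAt-↭ j ws))

invNum-swapAt : ∀ j ws → invNum (swapAt j ws) ≤ suc (invNum ws)
invNum-swapAt zero    []           = n≤1+n _
invNum-swapAt zero    (x ∷ [])     = n≤1+n _
invNum-swapAt zero    (x ∷ y ∷ zs) = +-cancelʳ-≤ (pairInv x y) _ _ (begin
  invNum (y ∷ x ∷ zs) + pairInv x y ≡⟨ invNum-swap-head x y zs ⟩
  invNum (x ∷ y ∷ zs) + pairInv y x ≤⟨ +-monoʳ-≤ (invNum (x ∷ y ∷ zs)) (pairInv-flip x y) ⟩
  invNum (x ∷ y ∷ zs) + suc (pairInv x y) ≡⟨ +-suc _ _ ⟩
  suc (invNum (x ∷ y ∷ zs)) + pairInv x y ∎)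
  where open ≤-Reasoning
invNum-swapAt (suc j) []           = n≤1+n _
invNum-swapAt (suc j) (x ∷ ws)     = begin
  invNum (x ∷ swapAt j ws)                            ≡⟨ invNum-cons-swapAt x j ws ⟩
  neg x + sumOf (pairInv x) ws + invNum (swapAt j ws) ≤⟨ +-monoʳ-≤ (neg x + sumOf (pairInv x) ws) (invNum-swapAt j ws) ⟩
  neg x + sumOf (pairInv x) ws + suc (invNum ws)      ≡⟨ +-suc _ _ ⟩
  suc (invNum (x ∷ ws))                               ∎
  where open ≤-Reasoning

invNum-applyGen : ∀ i ws → invNum (applyGen i ws) ≤ suc (invNum ws)
invNum-applyGen zero    []       = z≤n
invNum-applyGen zero    (x ∷ ws) = begin
  neg (- x) + sumOf (pairInv (- x)) ws + invNum ws ≡⟨ cong (λ t → neg (- x) + t + invNum ws) (sumOf-congᴬ (All.universal (pairInv-negate x) ws)) ⟩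
  neg (- x) + sumOf (pairInv x) ws + invNum ws     ≤⟨ +-monoˡ-≤ (invNum ws) (+-monoˡ-≤ (sumOf (pairInv x) ws) (neg≤suc (- x) x)) ⟩
  suc (neg x) + sumOf (pairInv x) ws + invNum ws   ∎
  where
  open ≤-Reasoning
  neg≤suc : ∀ y z → neg y ≤ suc (neg z)
  neg≤suc (+ _)    _ = z≤n
  neg≤suc -[1+ _ ] _ = s≤s z≤n
invNum-applyGen (suc i) ws = invNum-swapAt i ws

invNum-foldl : ∀ {n} w (ws : List (Fin n)) →
  invNum (foldl (λ w a → applyGen (toℕ a) w) w ws) ≤ invNum w + length ws
invNum-foldl w []       = ≤-reflexive (sym (+-identityʳ _))
invNum-foldl w (a ∷ ws) = begin
  invNum (foldl (λ w a → applyGen (toℕ a) w) (applyGen (toℕ a) w) ws) ≤⟨ invNum-foldl (applyGen (toℕ a) w) ws ⟩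
  invNum (applyGen (toℕ a) w) + length ws                            ≤⟨ +-monoˡ-≤ (length ws) (invNum-applyGen (toℕ a) w) ⟩
  suc (invNum w) + length ws                                          ≡⟨ sym (+-suc (invNum w) (length ws)) ⟩
  invNum w + suc (length ws)                                          ∎
  where open ≤-Reasoning

invNum-ascending : ∀ ns → Linked _≤_ ns → invNum (map +_ ns) ≡ 0
invNum-ascending []       _  = refl
invNum-ascending (a ∷ ns) lk = cong₂ _+_ no-pairs (invNum-ascending ns (Linked.tail lk))
  where
  a≤ns : All (a ≤_) ns
  a≤ns = linked-head ≤-trans lk
  no-pairs : sumOf (pairInv (+ a)) (map +_ ns) ≡ 0
  no-pairs = trans (sumOf-map (pairInv (+ a)) +_ ns) (sumOf-zero (All.map lt-≥ a≤ns))

oneTo-ascending : ∀ n → Linked _≤_ (oneTo n)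
oneTo-ascending n = subst (Linked _≤_) (sym (map-upTo suc n)) (applyUpTo⁺₂ suc n (λ i → n≤1+n (suc i)))

idW≡oneTo : ∀ n → idW n ≡ map +_ (oneTo n)
idW≡oneTo n = map-∘ (upTo n)

invNum-idW : ∀ n → invNum (idW n) ≡ 0
invNum-idW n = trans (cong invNum (idW≡oneTo n)) (invNum-ascending (oneTo n) (oneTo-ascending n))

inv≤wordLength : ∀ n w (ws : List (Fin n)) → evalWord n ws ≡ w → invNum w ≤ length ws
inv≤wordLength n w ws refl = ≤-trans (invNum-foldl (idW n) ws)
  (≤-reflexive (cong (_+ length ws) (invNum-idW n)))

-- Descents: generators that lower the inversion number by one

Descent : List ℤ → Set
Descent w = Σ ℕ λ i → i < length w × suc (invNum (applyGen i w)) ≡ invNum w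

Ascending : List ℤ → Set
Ascending w = Σ (List ℕ) λ ns → w ≡ map +_ ns × Linked _≤_ ns

descent-at-head : ∀ x y zs → pairInv x y ≡ suc (pairInv y x) → suc (invNum (y ∷ x ∷ zs)) ≡ invNum (x ∷ y ∷ zs)
descent-at-head x y zs flip = +-cancelʳ-≡ (pairInv y x) _ _ (begin
  suc (invNum (y ∷ x ∷ zs)) + pairInv y x ≡⟨ sym (+-suc _ _) ⟩
  invNum (y ∷ x ∷ zs) + suc (pairInv y x) ≡⟨ cong (_+_ (invNum (y ∷ x ∷ zs))) (sym flip) ⟩
  invNum (y ∷ x ∷ zs) + pairInv x y       ≡⟨ invNum-swap-head x y zs ⟩
  invNum (x ∷ y ∷ zs) + pairInv y x       ∎)
  where open ≡-Reasoning

descent-cons : ∀ x j ws → suc (invNum (swapAt j ws)) ≡ invNum ws → suc (invNum (x ∷ swapAt j ws)) ≡ invNum (x ∷ ws)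
descent-cons x j ws desc = begin
  suc (invNum (x ∷ swapAt j ws))                    ≡⟨ cong suc (invNum-cons-swapAt x j ws) ⟩
  suc (head-pairs + invNum (swapAt j ws))           ≡⟨ sym (+-suc head-pairs _) ⟩
  head-pairs + suc (invNum (swapAt j ws))           ≡⟨ cong (_+_ head-pairs) desc ⟩
  head-pairs + invNum ws                            ∎
  where
  open ≡-Reasoning
  head-pairs : ℕ
  head-pairs = neg x + sumOf (pairInv x) ws

descent-after : ∀ a ys →
  (Σ ℕ λ j → suc j < suc (length ys) × suc (invNum (swapAt j (+ a ∷ ys))) ≡ invNum (+ a ∷ ys))
  ⊎ (Σ (List ℕ) λ ns → ys ≡ map +_ ns × Linked _≤_ (a ∷ ns))
descent-after a []               = inj₂ ([] , refl , [-])
descent-after a (-[1+ b ] ∷ zs)  = inj₁ (0 , s≤s (s≤s z≤n) , descent-at-head (+ a) -[1+ b ] zs refl)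
descent-after a (+ b ∷ zs) with b <? a
... | yes b<a = inj₁ (0 , s≤s (s≤s z≤n) , descent-at-head (+ a) (+ b) zs (trans (lt-< b<a) (cong suc (sym (lt-≥ (<⇒≤ b<a))))))
... | no  b≮a with descent-after b zs
...   | inj₂ (ns , refl , lk)   = inj₂ (b ∷ ns , refl , ≮⇒≥ b≮a ∷ lk)
...   | inj₁ (j , j< , desc)    = inj₁ (suc j , s≤s j< , descent-cons (+ a) j (+ b ∷ zs) desc)

descent-or-ascending : ∀ w → Descent w ⊎ Ascending w
descent-or-ascending []               = inj₂ ([] , refl , [])
descent-or-ascending (-[1+ a ] ∷ xs)  =
  inj₁ (0 , s≤s z≤n , cong (λ t → suc (t + invNum xs)) (sumOf-congᴬ (All.universal (pairInv-negate -[1+ a ]) xs)))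
descent-or-ascending (+ a ∷ xs) with descent-after a xs
... | inj₁ (j , j< , desc)     = inj₁ (suc j , j< , desc)
... | inj₂ (ns , refl , lk)    = inj₂ (a ∷ ns , refl , lk)

ascending⇒id : ∀ n w → Ascending w → IsSignedPerm n w → w ≡ idW n
ascending⇒id n _ (ns , refl , lk) perm = trans (cong (λ ms → map +_ ms) ns≡oneTo) (sym (idW≡oneTo n))
  where
  ns↭ : ns ↭ oneTo n
  ns↭ = subst (_↭ oneTo n) (trans (sym (map-∘ ns)) (map-id ns)) perm
  ns≡oneTo : ns ≡ oneTo n
  ns≡oneTo = Pointwise-≡⇒≡ (↗↭↗⇒≋ ≤-totalOrder lk (oneTo-ascending n) (↭⇒↭ₛ ns↭))

-- each generator is an involution, so appending s_i to a word for w s_i gives w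
applyGen-involutive : ∀ i w → applyGen i (applyGen i w) ≡ w
applyGen-involutive zero    []       = refl
applyGen-involutive zero    (x ∷ w)  = cong (_∷ w) (neg-involutive x)
applyGen-involutive (suc i) w        = swapAt-involutive i w
  where
  swapAt-involutive : ∀ j (xs : List ℤ) → swapAt j (swapAt j xs) ≡ xs
  swapAt-involutive zero    []           = refl
  swapAt-involutive zero    (x ∷ [])     = refl
  swapAt-involutive zero    (x ∷ y ∷ xs) = refl
  swapAt-involutive (suc j) []           = refl
  swapAt-involutive (suc j) (x ∷ xs)     = cong (x ∷_) (swapAt-involutive j xs)

applyGen-↭ : ∀ i w → map ∣_∣ (applyGen i w) ↭ map ∣_∣ w
applyGen-↭ zero    []      = ↭-refl
applyGen-↭ zero    (x ∷ w) = subst (λ t → t ∷ map ∣_∣ w ↭ ∣ x ∣ ∷ map ∣_∣ w) (sym (∣-i∣≡∣i∣ x)) ↭-refl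
applyGen-↭ (suc i) w       = ↭.map⁺ ∣_∣ (swapAt-↭ i w)

applyGen-length : ∀ i w → length (applyGen i w) ≡ length w
applyGen-length zero    []      = refl
applyGen-length zero    (x ∷ w) = refl
applyGen-length (suc i) w       = ↭.↭-length (swapAt-↭ i w)

reducedWord : ∀ n m w → invNum w ≡ m → length w ≡ n → IsSignedPerm n w →
  Σ (List (Fin n)) λ ws → length ws ≡ m × evalWord n ws ≡ w
reducedWord n m w inv≡ len perm with descent-or-ascending w
... | inj₂ asc = [] , trans (sym (trans (cong invNum w≡id) (invNum-idW n))) inv≡ , sym w≡id
  where
  w≡id : w ≡ idW n
  w≡id = ascending⇒id n w asc perm
reducedWord n zero    w inv≡ len perm | inj₁ (i , i< , desc) with () ← trans desc inv≡
reducedWord n (suc m) w inv≡ len perm | inj₁ (i , i< , desc)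
  with reducedWord n m (applyGen i w) (suc-injective (trans desc inv≡))
         (trans (applyGen-length i w) len) (↭-trans (applyGen-↭ i w) perm)
... | ws , len-ws , eval-ws = ws ++ [ s ] , length≡ , eval≡
  where
  i<n : i < n
  i<n = subst (i <_) len i<
  s : Fin n
  s = fromℕ< i<n
  length≡ : length (ws ++ [ s ]) ≡ suc m
  length≡ = trans (length-++ ws) (trans (+-comm (length ws) 1) (cong suc len-ws))
  eval≡ : evalWord n (ws ++ [ s ]) ≡ w
  eval≡ = begin
    evalWord n (ws ++ [ s ])         ≡⟨ foldl-++ _ (idW n) ws [ s ] ⟩
    applyGen (toℕ s) (evalWord n ws) ≡⟨ cong₂ applyGen (toℕ-fromℕ< i<n) eval-ws ⟩
    applyGen i (applyGen i w)        ≡⟨ applyGen-involutive i w ⟩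
    w                                ∎
    where open ≡-Reasoning

coxeterLength-inv : ∀ n w → length w ≡ n → IsSignedPerm n w → CoxeterLength n w (invNum w)
coxeterLength-inv n w len perm = reducedWord n (invNum w) w refl len perm , inv≤wordLength n w

-- Inversions of the blocks of u | λ̄ v

negℕ : ℕ → ℤ
negℕ x = - (+ x)

cross : List ℤ → List ℤ → ℕ
cross a b = sumOf (λ x → sumOf (pairInv x) b) a

invNum-++ : ∀ a b → invNum (a ++ b) ≡ invNum a + invNum b + cross a b
invNum-++ []      b = sym (+-identityʳ (invNum b))
invNum-++ (x ∷ a) b =
  trans (cong₂ (λ s t → neg x + s + t) (sumOf-++ (pairInv x) a b) (invNum-++ a b))
        (regroup (neg x) (sumOf (pairInv x) a) (sumOf (pairInv x) b) (invNum a) (invNum b) (cross a b))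
  where
  regroup : ∀ n p q la lb c → n + (p + q) + (la + lb + c) ≡ n + p + la + lb + (q + c)
  regroup = solve-∀

cross-++ : ∀ a b d → cross a (b ++ d) ≡ cross a b + cross a d
cross-++ a b d = trans (sumOf-congᴬ (All.universal (λ x → sumOf-++ (pairInv x) b d) a)) (sumOf-+ _ _ a)

pairs-pos-pos : ∀ a ys → sumOf (pairInv (+ a)) (map +_ ys) ≡ below a ys
pairs-pos-pos a ys = sumOf-map (pairInv (+ a)) +_ ys

-- a positive entry a before negative entries -y: always inverted, and again when a < y
pairs-pos-neg : ∀ a ys → All (0 <_) ys → sumOf (pairInv (+ a)) (map negℕ ys) ≡ length ys + above a ys
pairs-pos-neg a ys pos =
  trans (sumOf-map (pairInv (+ a)) negℕ ys) (trans (sumOf-congᴬ (All.map pos-neg pos)) (sumOf-suc (lt a) ys))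
  where
  pos-neg : ∀ {y} → 0 < y → pairInv (+ a) (negℕ y) ≡ suc (lt a y)
  pos-neg {suc y} _ = refl

pairs-neg-pos : ∀ {a} ys → 0 < a → sumOf (pairInv (negℕ a)) (map +_ ys) ≡ below a ys
pairs-neg-pos {suc a} ys _ = sumOf-map (pairInv -[1+ a ]) +_ ys

pairs-neg-neg : ∀ {x} zs → All (x <_) zs → cross (map negℕ zs) [ negℕ (suc x) ] ≡ length zs
pairs-neg-neg []       []                    = refl
pairs-neg-neg (suc z ∷ zs) (s≤s x≤z ∷ x<zs) =
  cong suc (cong₂ _+_ (trans (+-identityʳ _) (lt-≥ x≤z)) (pairs-neg-neg zs x<zs))

-- the block λ̄ = -λ_r … -λ_1 has r negative entries and all of its pairs inverted
invNum-negBlock : ∀ lam → All (0 <_) lam → Linked _<_ lam →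
  invNum (reverse (map negℕ lam)) ≡ length lam + sumOf (λ y → below y lam) lam
invNum-negBlock []              _              _  = refl
invNum-negBlock (suc x ∷ xs) (_ ∷ pos) lk = begin
  invNum (reverse (negℕ (suc x) ∷ map negℕ xs))            ≡⟨ cong invNum (unfold-reverse (negℕ (suc x)) (map negℕ xs)) ⟩
  invNum (R ++ [ negℕ (suc x) ])                          ≡⟨ invNum-++ R [ negℕ (suc x) ] ⟩
  invNum R + 1 + cross R [ negℕ (suc x) ]                  ≡⟨ cong₂ (λ s t → s + 1 + t) (invNum-negBlock xs pos (Linked.tail lk)) new-pairs ⟩
  length xs + S + 1 + length xs                            ≡⟨ regroup (length xs) S ⟩
  suc (length xs) + (length xs + S)                        ≡⟨ cong (_+_ (suc (length xs))) (sym (sum-below-self lk)) ⟩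
  suc (length xs) + sumOf (λ y → below y (suc x ∷ xs)) (suc x ∷ xs) ∎
  where
  open ≡-Reasoning
  R : List ℤ
  R = reverse (map negℕ xs)
  S : ℕ
  S = sumOf (λ y → below y xs) xs
  new-pairs : cross R [ negℕ (suc x) ] ≡ length xs
  new-pairs = trans (sumOf-↭ _ (↭-reverse (map negℕ xs))) (pairs-neg-neg xs (All.map (λ 1+x<z → ≤-trans (n≤1+n _) 1+x<z) (linked-head <-trans lk)))
  regroup : ∀ a s → a + s + 1 + a ≡ suc a + (a + s)
  regroup = solve-∀

inv-oneLine-blocks : ∀ u lam v → IncPos u → IncPos lam → IncPos v →
  invNum (oneLine u lam v) ≡
    sumOf (λ x → length lam + above x lam) u + sumOf (λ x → below x v) u
    + (length lam + sumOf (λ y → below y lam) lam + sumOf (λ y → below y v) lam)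
inv-oneLine-blocks u lam v (_ , lu) (pl , ll) (_ , lv) = begin
  invNum (U ++ R ++ V)                                                 ≡⟨ invNum-++ U (R ++ V) ⟩
  invNum U + invNum (R ++ V) + cross U (R ++ V)                        ≡⟨ cong₂ (λ s t → invNum U + s + t) (invNum-++ R V) (cross-++ U R V) ⟩
  invNum U + (invNum R + invNum V + cross R V) + (cross U R + cross U V)
    ≡⟨ cong₂ _+_ (cong₂ _+_ invU (cong₂ _+_ (cong₂ _+_ (invNum-negBlock lam pl ll) invV) crossRV)) (cong₂ _+_ crossUR crossUV) ⟩
  0 + (length lam + Sll + 0 + Slv) + (Sur + Suv)                       ≡⟨ regroup (length lam + Sll) Slv Sur Suv ⟩
  Sur + Suv + (length lam + Sll + Slv)                                 ∎
  where
  open ≡-Reasoning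
  U R V : List ℤ
  U = map +_ u
  R = reverse (map negℕ lam)
  V = map +_ v
  Sll Slv Sur Suv : ℕ
  Sll = sumOf (λ y → below y lam) lam
  Slv = sumOf (λ y → below y v) lam
  Sur = sumOf (λ x → length lam + above x lam) u
  Suv = sumOf (λ x → below x v) u
  invU : invNum U ≡ 0
  invU = invNum-ascending u (Linked.map <⇒≤ lu)
  invV : invNum V ≡ 0
  invV = invNum-ascending v (Linked.map <⇒≤ lv)
  crossRV : cross R V ≡ Slv
  crossRV = trans (sumOf-↭ _ (↭-reverse (map negℕ lam)))
    (trans (sumOf-map _ negℕ lam) (sumOf-congᴬ (All.map (pairs-neg-pos v) pl)))
  crossUR : cross U R ≡ Sur
  crossUR = trans (sumOf-map _ +_ u)
    (sumOf-congᴬ (All.universal (λ x → trans (sumOf-↭ _ (↭-reverse (map negℕ lam))) (pairs-pos-neg x lam pl)) u))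
  crossUV : cross U V ≡ Suv
  crossUV = trans (sumOf-map _ +_ u) (sumOf-congᴬ (All.universal (λ x → pairs-pos-pos x v) u))
  regroup : ∀ a b c d → 0 + (a + 0 + b) + (c + d) ≡ c + d + (a + b)
  regroup = solve-∀

abs-oneLine : ∀ u lam v → map ∣_∣ (oneLine u lam v) ≡ u ++ reverse lam ++ v
abs-oneLine u lam v = begin
  map ∣_∣ (map +_ u ++ R ++ map +_ v)                     ≡⟨ map-++ ∣_∣ (map +_ u) (R ++ map +_ v) ⟩
  map ∣_∣ (map +_ u) ++ map ∣_∣ (R ++ map +_ v)           ≡⟨ cong₂ _++_ (abs-pos u) (map-++ ∣_∣ R (map +_ v)) ⟩
  u ++ map ∣_∣ R ++ map ∣_∣ (map +_ v)                    ≡⟨ cong₂ (λ s t → u ++ s ++ t) abs-R (abs-pos v) ⟩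
  u ++ reverse lam ++ v                                    ∎
  where
  open ≡-Reasoning
  R : List ℤ
  R = reverse (map negℕ lam)
  abs-pos : ∀ xs → map ∣_∣ (map +_ xs) ≡ xs
  abs-pos xs = trans (sym (map-∘ xs)) (map-id xs)
  abs-R : map ∣_∣ R ≡ reverse lam
  abs-R = trans (reverse-map ∣_∣ (map negℕ lam))
    (cong reverse (trans (sym (map-∘ lam)) (trans (map-cong (λ x → ∣-i∣≡∣i∣ (+ x)) lam) (map-id lam))))

length-oneLine : ∀ u lam v → length (oneLine u lam v) ≡ length u + length lam + length v
length-oneLine u lam v = begin
  length (oneLine u lam v)                    ≡⟨ sym (length-map ∣_∣ (oneLine u lam v)) ⟩
  length (map ∣_∣ (oneLine u lam v))          ≡⟨ cong length (abs-oneLine u lam v) ⟩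
  length (u ++ reverse lam ++ v)              ≡⟨ length-++ u ⟩
  length u + length (reverse lam ++ v)        ≡⟨ cong (_+_ (length u)) (trans (length-++ (reverse lam)) (cong (_+ length v) (length-reverse lam))) ⟩
  length u + (length lam + length v)          ≡⟨ sym (+-assoc (length u) _ _) ⟩
  length u + length lam + length v            ∎
  where open ≡-Reasoning

sumOf-++₃ : ∀ {A : Set} (f : A → ℕ) xs ys zs → sumOf f (xs ++ ys ++ zs) ≡ sumOf f xs + (sumOf f ys + sumOf f zs)
sumOf-++₃ f xs ys zs = trans (sumOf-++ f xs (ys ++ zs)) (cong (_+_ (sumOf f xs)) (sumOf-++ f ys zs))

-- an entry occurring in one block of a list that contains it once is absent from the other blocks
once-in-block : ∀ {a b c} → 1 ≤ a → a + (b + c) ≡ 1 → b ≡ 0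
once-in-block {suc a} {b} _ eq = m+n≡0⇒m≡0 b (m+n≡0⇒n≡0 a (suc-injective eq))

-- arithmetic behind α_i = r + #{v below u_i}
alpha-value : ∀ {x bu bl bv c a r} → x ≡ suc (bu + (bl + bv)) → bl + c + a ≡ r → c ≡ 0 →
  (x + a) ∸ suc bu ≡ r + bv
alpha-value {bu = bu} {bl} {bv} {a = a} refl refl refl =
  trans (cong (_∸ suc bu) (regroup bu bl bv a)) (m+n∸m≡n (suc bu) (bl + 0 + a + bv))
  where
  regroup : ∀ p q s t → suc (p + (q + s)) + t ≡ suc p + (q + 0 + t + s)
  regroup = solve-∀

sum-alphas : ∀ {n} u lam v → Linked _<_ u → u ++ lam ++ v ↭ oneTo n →
  sum (alphas u lam) ≡ sumOf (λ _ → length lam) u + sumOf (λ x → below x v) u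
sum-alphas u lam v lu p = begin
  sum (alphas u lam)                       ≡⟨ sum-zipWith-rank α id u lu ⟩
  sumOf (λ x → α (below x u) x) u          ≡⟨ sumOf-congᴬ {xs = u} (All.tabulate α-at) ⟩
  sumOf (λ x → length lam + below x v) u   ≡⟨ sumOf-+ (λ _ → length lam) (λ x → below x v) u ⟩
  sumOf (λ _ → length lam) u + sumOf (λ x → below x v) u ∎
  where
  open ≡-Reasoning
  α : ℕ → ℕ → ℕ
  α i x = (x + dCount lam x) ∸ suc i
  α-at : ∀ {x} → x ∈ u → α (below x u) x ≡ length lam + below x v
  α-at {x} x∈ with rank-perm p (∈-++⁺ˡ x∈)
  ... | x≡ , once = trans (cong (λ d → (x + d) ∸ suc (below x u)) (dCount≡above lam x))
    (alpha-value (trans x≡ (cong suc (sumOf-++₃ _ u lam v))) (counts-partition x lam)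
                 (once-in-block (∈⇒copies x∈) (trans (sym (sumOf-++₃ _ u lam v)) once)))

sum-lam : ∀ {n} u lam v → u ++ lam ++ v ↭ oneTo n →
  sum lam ≡ length lam + (sumOf (λ y → below y u) lam + (sumOf (λ y → below y lam) lam + sumOf (λ y → below y v) lam))
sum-lam u lam v p = begin
  sum lam                                    ≡⟨ cong sum (sym (map-id lam)) ⟩
  sumOf id lam                               ≡⟨ sumOf-congᴬ {xs = lam} (All.tabulate (λ y∈ → proj₁ (rank-perm p (∈-++⁺ʳ u (∈-++⁺ˡ y∈))))) ⟩
  sumOf (λ y → suc (below y (u ++ lam ++ v))) lam ≡⟨ sumOf-suc _ lam ⟩
  length lam + sumOf (λ y → below y (u ++ lam ++ v)) lam
    ≡⟨ cong (_+_ (length lam)) (trans (sumOf-congᴬ (All.universal (λ y → sumOf-++₃ _ u lam v) lam))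
                                     (trans (sumOf-+ _ _ lam) (cong (_+_ _) (sumOf-+ _ _ lam)))) ⟩
  length lam + (sumOf (λ y → below y u) lam + (sumOf (λ y → below y lam) lam + sumOf (λ y → below y v) lam)) ∎
  where open ≡-Reasoning

invNum-oneLine : ∀ n u lam v → IncPos u → IncPos lam → IncPos v → IsSignedPerm n (oneLine u lam v) →
  invNum (oneLine u lam v) ≡ sum (alphas u lam) + sum lam
invNum-oneLine n u lam v iu il iv perm = begin
  invNum (oneLine u lam v)                            ≡⟨ inv-oneLine-blocks u lam v iu il iv ⟩
  sumOf (λ x → r + above x lam) u + Suv + (r + Sll + Slv)
    ≡⟨ cong (λ t → t + Suv + (r + Sll + Slv)) (trans (sumOf-+ (λ _ → r) (λ x → above x lam) u) (cong (_+_ K) (double-count u lam))) ⟩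
  K + Slu + Suv + (r + Sll + Slv)                     ≡⟨ regroup K Slu Suv r Sll Slv ⟩
  K + Suv + (r + (Slu + (Sll + Slv)))                 ≡⟨ cong₂ _+_ (sym (sum-alphas u lam v (proj₂ iu) blocks↭)) (sym (sum-lam u lam v blocks↭)) ⟩
  sum (alphas u lam) + sum lam                        ∎
  where
  open ≡-Reasoning
  r K Sll Slv Slu Suv : ℕ
  r = length lam
  K = sumOf (λ _ → r) u
  Sll = sumOf (λ y → below y lam) lam
  Slv = sumOf (λ y → below y v) lam
  Slu = sumOf (λ y → below y u) lam
  Suv = sumOf (λ x → below x v) u
  regroup : ∀ k a b r c d → k + a + b + (r + c + d) ≡ k + b + (r + (a + (c + d)))
  regroup = solve-∀
  blocks↭ : u ++ lam ++ v ↭ oneTo n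
  blocks↭ = ↭-trans (↭-sym (++⁺ˡ u (++⁺ʳ v (↭-reverse lam)))) (subst (_↭ oneTo n) (abs-oneLine u lam v) perm)

mainTheorem2 : (n k : ℕ) → 1 ≤ n → k ≤ n →
    (u lam v : List ℕ) →
    length u ≡ k → length u + length lam + length v ≡ n →
    IncPos u → IncPos lam → IncPos v →
    IsSignedPerm n (oneLine u lam v) →
    CoxeterLength n (oneLine u lam v) (sum (alphas u lam) + sum lam)
mainTheorem2 n _ _ _ u lam v _ len iu il iv perm =
  subst (CoxeterLength n (oneLine u lam v)) (invNum-oneLine n u lam v iu il iv perm)
    (coxeterLength-inv n (oneLine u lam v) (trans (length-oneLine u lam v) len) perm)
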